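{- Let $p$ be a prime, and let $f(x)=\sum_{m=0}^{\infty}B_m\chi(m,x)$ and $g(x)=\sum_{m=0}^{\infty}\tilde B_m\chi(m,x)$ be 1-Lipschitz functions $\mathbb{Z}_p\to\mathbb{Z}_p$ (in van der Put expansion) with $f(x)=\Delta g(x):=g(x+1)-g(x)$. Then: (a) $B_m=\tilde B_{m+1}-\tilde B_m$ for $0\le m\le p-2$; (b) $B_{p-1}=\tilde B_p+\tilde B_0-\tilde B_{p-1}$; (c) for $n\ge2$ and $p^{n-1}\le m\le p^n-1$, letting $m_{n-1}\in\{1,\dots,p-1\}$ be the leading base-$p$ digit of $m$: if $m\ne p^{n-1}-1+m_{n-1}p^{n-1}$ then $B_m=\tilde B_{m+1}-\tilde B_m$; (d) for $n\ge2$ and $m=p^{n-1}-1+m_{n-1}p^{n-1}$ with $1\le m_{n-1}\le p-1$: $B_m=\tilde B_{m+1}-\tilde B_m-\tilde B_{p^{n-1}}$.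
   Context: $\mathbb{Z}_p$ is the ring of $p$-adic integers with absolute value $|x|_p=p^{ -\mathrm{ord}(x)}$. A function $f:\mathbb{Z}_p\to\mathbb{Z}_p$ is 1-Lipschitz if $|f(x)-f(y)|_p\le|x-y|_p$ for all $x,y$. For an integer $m>0$ with base-$p$ expansion $m=m_0+m_1p+\dots+m_sp^s$ ($0\le m_i\le p-1$, $m_s\ne0$), put $q(m)=m_sp^s$. The van der Put basis is: for $m>0$, $\chi(m,x)=1$ if $|x-m|_p\le p^{ -\lfloor\log_p m\rfloor-1}$ and $0$ otherwise; $\chi(0,x)=1$ if $|x|_p\le p^{ -1}$ and $0$ otherwise. Every continuous $h:\mathbb{Z}_p\to\mathbb{Z}_p$ has a unique expansion $h(x)=\sum_{m\ge0}C_m\chi(m,x)$ with $C_m\in\mathbb{Z}_p$, where $C_m=h(m)$ for $0\le m\le p-1$ and $C_m=h(m)-h(m-q(m))$ for $m\ge p$. -}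

module Defs where

open import Data.Nat as ℕ using (ℕ; zero; suc; _<?_; _^_)
open import Data.Nat.DivMod using (_/_)
open import Data.Integer as ℤ using (ℤ; +_; _+_; _-_; -_)
open import Data.Integer.Divisibility.Signed using (_∣_; ∣m∣n⇒∣m+n; ∣m∣n⇒∣m-n)
open import Data.Integer.Tactic.RingSolver using (solve-∀)
open import Relation.Binary.PropositionalEquality using (_≡_; subst; sym)
open import Relation.Nullary using (yes; no)

-- The ring ℤ_p of p-adic integers, as the inverse limit of ℤ/p^n ℤ:
-- a p-adic integer is a sequence of integers (x_n) with
-- x_{n+1} ≡ x_n (mod p^n).  (x_n is a representative of x mod p^n.)

record ℤp (p : ℕ) : Set where
  constructor mkℤp
  field
    seq    : ℕ → ℤ
    compat : ∀ n → (+ (p ^ n)) ∣ (seq (suc n) - seq n)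
open ℤp public

module _ {p : ℕ} where

  _≡[_]_ : ℤp p → ℕ → ℤp p → Set
  x ≡[ k ] y = (+ (p ^ k)) ∣ (seq x k - seq y k)

  _≈_ : ℤp p → ℤp p → Set
  x ≈ y = ∀ k → x ≡[ k ] y

  private
    lem+ : ∀ a a' b b' → (a' + b') - (a + b) ≡ (a' - a) + (b' - b)
    lem+ = solve-∀
    lem- : ∀ a a' b b' → (a' - b') - (a - b) ≡ (a' - a) - (b' - b)
    lem- = solve-∀

  _+ₚ_ : ℤp p → ℤp p → ℤp p
  x +ₚ y = mkℤp (λ n → seq x n + seq y n)
    (λ n → subst (+ (p ^ n) ∣_)
       (sym (lem+ (seq x n) (seq x (suc n)) (seq y n) (seq y (suc n))))
       (∣m∣n⇒∣m+n (compat x n) (compat y n)))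

  _-ₚ_ : ℤp p → ℤp p → ℤp p
  x -ₚ y = mkℤp (λ n → seq x n - seq y n)
    (λ n → subst (+ (p ^ n) ∣_)
       (sym (lem- (seq x n) (seq x (suc n)) (seq y n) (seq y (suc n))))
       (∣m∣n⇒∣m-n (compat x n) (compat y n)))

  infixl 6 _+ₚ_ _-ₚ_
  infix 4 _≈_ _≡[_]_

ι : {p : ℕ} → ℕ → ℤp p
ι {p} m = mkℤp (λ _ → + m) (λ n → subst (+ (p ^ n) ∣_) (sym (lem m)) (∣0 n))
  where
    lem : ∀ m → (+ m) - (+ m) ≡ + 0
    lem m = Data.Integer.Properties.+-inverseʳ (+ m)
      where import Data.Integer.Properties
    ∣0 : ∀ n → (+ (p ^ n)) ∣ (+ 0)
    ∣0 n = Data.Integer.Divisibility.Signed.divides (+ 0) refl0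
      where
        import Data.Integer.Divisibility.Signed
        refl0 = sym (Data.Integer.Properties.*-zeroˡ (+ (p ^ n)))
          where import Data.Integer.Properties

-- 1-Lipschitz: |f x - f y|_p ≤ |x - y|_p, i.e.
-- x ≡ y (mod p^k) implies f x ≡ f y (mod p^k), for all k.
OneLipschitz : {p : ℕ} → (ℤp p → ℤp p) → Set
OneLipschitz {p} f = ∀ k (x y : ℤp p) → x ≡[ k ] y → f x ≡[ k ] f y

Δ : {p : ℕ} → (ℤp p → ℤp p) → ℤp p → ℤp p
Δ g x = g (x +ₚ ι 1) -ₚ g x

-- q(m) = m_s p^s, where m_s is the leading base-p digit of m > 0.
-- Computed as q(m) = m if m < p, q(m) = p * q(⌊m/p⌋) otherwise
-- (the first argument is fuel; fuel m suffices for p ≥ 2).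

qAux : ℕ → ℕ → ℕ → ℕ
qAux zero          p       m = m
qAux (suc fuel)    zero    m = m
qAux (suc fuel)    (suc p) m with m <? suc p
... | yes _ = m
... | no  _ = suc p ℕ.* qAux fuel (suc p) (m / suc p)

q : ℕ → ℕ → ℕ
q p m = qAux m p m

vdP : {p : ℕ} → (ℤp p → ℤp p) → ℕ → ℤp p
vdP {p} h m with m <? p
... | yes _ = h (ι m)
... | no  _ = h (ι m) -ₚ h (ι (m ℕ.∸ q p m))

-- At a natural number m, f = Δg takes the value g(m+1) - g(m), so every van der
-- Put coefficient of f is a signed sum of four values of g at natural numbers
-- and every coefficient of g a difference of at most two.  Comparing them only
-- requires m - q(m) and (m+1) - q(m+1): if m = d p^s + r with leading digit d,
-- then q(m) = d p^s and m - q(m) = r.  Passing from m to m+1 keeps the leading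
-- digit unless r = p^s - 1; then m+1 = (d+1) p^s (possibly p^(s+1)) is its own
-- q, and g(0) enters, which produces the extra term in (d).

module Submission where

open import Defs
open import Data.Nat using (ℕ; suc; _+_; _*_; _∸_; _^_; _≤_)
open import Data.Nat.Primality using (Prime)
open import Data.Product using (_×_)
open import Relation.Binary.PropositionalEquality using (_≢_)

open import Data.Nat as ℕ using (zero; _<_; _<?_; z≤n; s≤s)
open import Data.Nat.Properties
open import Data.Nat.DivMod using (_/_; _%_; m≡m%n+[m/n]*n; m%n<n; m≥n⇒m/n>0; m<n*o⇒m/o<n; +-distrib-/-∣ˡ; m*n/n≡m)
open import Data.Nat.Divisibility using (divides)
open import Data.Integer as ℤ using (ℤ; +_)
import Data.Integer.Properties as ℤ
open import Data.Integer.Divisibility.Signed using (∣m∣n⇒∣m+n; ∣m∣n⇒∣m-n; ∣m⇒∣-m) renaming (_∣_ to _∣ℤ_)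
import Data.Integer.Divisibility.Signed as ℤ∣
open import Data.Integer.Tactic.RingSolver as ℤ-Solver using ()
open import Algebra.Properties.CommutativeSemigroup *-commutativeSemigroup using (x∙yz≈y∙xz; x∙yz≈xz∙y)
open import Data.Product using (_,_; ∃₂)
open import Data.Sum using (inj₁; inj₂)
open import Level using (0ℓ)
open import Relation.Binary.Bundles using (Setoid)
open import Relation.Binary.PropositionalEquality
  using (_≡_; refl; sym; trans; cong; cong₂; subst; module ≡-Reasoning)
open import Relation.Nullary using (yes; no; contradiction)

module _ {p : ℕ} where

  infix 4 _≃_

  -- A record rather than the function type _≈_, so that both sides can be
  -- inferred from a proof.
  record _≃_ (x y : ℤp p) : Set where
    constructor ⟦_⟧
    field ≃⇒≈ : x ≈ y
  open _≃_ public

  private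
    p^_ : ℕ → ℤ
    p^ j = + (p ^ j)

    x-x≡0 : ∀ x → x ℤ.- x ≡ + 0
    x-x≡0 x = ℤ.+-inverseʳ x

    -[x-y]≡y-x : ∀ x y → ℤ.- (x ℤ.- y) ≡ y ℤ.- x
    -[x-y]≡y-x = ℤ-Solver.solve-∀

    [x-y]+[y-z]≡x-z : ∀ x y z → (x ℤ.- y) ℤ.+ (y ℤ.- z) ≡ x ℤ.- z
    [x-y]+[y-z]≡x-z = ℤ-Solver.solve-∀

    [x+y]-[x'+y']≡[x-x']+[y-y'] : ∀ x x' y y' →
      (x ℤ.+ y) ℤ.- (x' ℤ.+ y') ≡ (x ℤ.- x') ℤ.+ (y ℤ.- y')
    [x+y]-[x'+y']≡[x-x']+[y-y'] = ℤ-Solver.solve-∀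

    [x-y]-[x'-y']≡[x-x']-[y-y'] : ∀ x x' y y' →
      (x ℤ.- y) ℤ.- (x' ℤ.- y') ≡ (x ℤ.- x') ℤ.- (y ℤ.- y')
    [x-y]-[x'-y']≡[x-x']-[y-y'] = ℤ-Solver.solve-∀

  seq-≡⇒≃ : {x y : ℤp p} → (∀ j → seq x j ≡ seq y j) → x ≃ y
  seq-≡⇒≃ {x} {y} eq = ⟦ (λ j → subst (p^ j ∣ℤ_)
    (trans (sym (x-x≡0 (seq y j))) (cong (ℤ._- seq y j) (sym (eq j))))
    (ℤ∣.divides (+ 0) (sym (ℤ.*-zeroˡ (p^ j))))) ⟧

  ≃-refl : {x : ℤp p} → x ≃ x
  ≃-refl = seq-≡⇒≃ (λ _ → refl)

  ≃-sym : {x y : ℤp p} → x ≃ y → y ≃ x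
  ≃-sym {x} {y} ⟦ x≈y ⟧ = ⟦ (λ j → subst (p^ j ∣ℤ_)
    (-[x-y]≡y-x (seq x j) (seq y j)) (∣m⇒∣-m (x≈y j))) ⟧

  ≃-trans : {x y z : ℤp p} → x ≃ y → y ≃ z → x ≃ z
  ≃-trans {x} {y} {z} ⟦ x≈y ⟧ ⟦ y≈z ⟧ = ⟦ (λ j → subst (p^ j ∣ℤ_)
    ([x-y]+[y-z]≡x-z (seq x j) (seq y j) (seq z j)) (∣m∣n⇒∣m+n (x≈y j) (y≈z j))) ⟧

  -- The endpoints of a congruence are read off its arguments, not unified
  -- against the expected type: that unification would unfold _-ₚ_ and
  -- normalise the ring-solver proofs in its compat field.
  Cong₂ : (ℤp p → ℤp p → ℤp p) → {x x' y y' : ℤp p} → x ≃ x' → y ≃ y' → Set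
  Cong₂ _∙_ {x} {x'} {y} {y'} _ _ = x ∙ y ≃ x' ∙ y'

  +ₚ-cong : {x x' y y' : ℤp p} (x≃x' : x ≃ x') (y≃y' : y ≃ y') → Cong₂ _+ₚ_ x≃x' y≃y'
  +ₚ-cong {x} {x'} {y} {y'} ⟦ x≈x' ⟧ ⟦ y≈y' ⟧ = ⟦ (λ j → subst (p^ j ∣ℤ_)
    (sym ([x+y]-[x'+y']≡[x-x']+[y-y'] (seq x j) (seq x' j) (seq y j) (seq y' j)))
    (∣m∣n⇒∣m+n (x≈x' j) (y≈y' j))) ⟧

  -ₚ-cong : {x x' y y' : ℤp p} (x≃x' : x ≃ x') (y≃y' : y ≃ y') → Cong₂ _-ₚ_ x≃x' y≃y'
  -ₚ-cong {x} {x'} {y} {y'} ⟦ x≈x' ⟧ ⟦ y≈y' ⟧ = ⟦ (λ j → subst (p^ j ∣ℤ_)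
    (sym ([x-y]-[x'-y']≡[x-x']-[y-y'] (seq x j) (seq x' j) (seq y j) (seq y' j)))
    (∣m∣n⇒∣m-n (x≈x' j) (y≈y' j))) ⟧

  -ₚ-interchange : (a b c e : ℤp p) → (a -ₚ b) -ₚ (c -ₚ e) ≃ (a -ₚ c) -ₚ (b -ₚ e)
  -ₚ-interchange a b c e = seq-≡⇒≃ (λ j → identity (seq a j) (seq b j) (seq c j) (seq e j))
    where
    identity : ∀ a b c e → (a ℤ.- b) ℤ.- (c ℤ.- e) ≡ (a ℤ.- c) ℤ.- (b ℤ.- e)
    identity = ℤ-Solver.solve-∀

  -ₚ-interchange-via : (a b c e z : ℤp p) →
                       (a -ₚ b) -ₚ (c -ₚ e) ≃ ((a -ₚ z) -ₚ (b -ₚ e)) -ₚ (c -ₚ z)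
  -ₚ-interchange-via a b c e z =
    seq-≡⇒≃ (λ j → identity (seq a j) (seq b j) (seq c j) (seq e j) (seq z j))
    where
    identity : ∀ a b c e z →
               (a ℤ.- b) ℤ.- (c ℤ.- e) ≡ ((a ℤ.- z) ℤ.- (b ℤ.- e)) ℤ.- (c ℤ.- z)
    identity = ℤ-Solver.solve-∀

  -ₚ-via : (a c z : ℤp p) → a -ₚ c ≃ (a -ₚ z) +ₚ z -ₚ c
  -ₚ-via a c z = seq-≡⇒≃ (λ j → identity (seq a j) (seq c j) (seq z j))
    where
    identity : ∀ a c z → a ℤ.- c ≡ (a ℤ.- z) ℤ.+ z ℤ.- c
    identity = ℤ-Solver.solve-∀

≃-setoid : ℕ → Setoid 0ℓ 0ℓ
≃-setoid p = record
  { Carrier = ℤp p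
  ; _≈_ = _≃_
  ; isEquivalence = record { refl = ≃-refl ; sym = ≃-sym ; trans = ≃-trans }
  }

module _ {p : ℕ} where

  OneLipschitz⇒≃-cong : (h : ℤp p → ℤp p) → OneLipschitz h →
                        {x y : ℤp p} → x ≃ y → h x ≃ h y
  OneLipschitz⇒≃-cong h h-lip {x} {y} ⟦ x≈y ⟧ = ⟦ (λ j → h-lip j x y (x≈y j)) ⟧

  ι-+1 : ∀ m → ι {p} m +ₚ ι 1 ≃ ι (suc m)
  ι-+1 m = seq-≡⇒≃ (λ _ → trans (sym (ℤ.pos-+ m 1)) (cong +_ (+-comm m 1)))

  Δ-ι : (g : ℤp p → ℤp p) → OneLipschitz g →
        ∀ m → Δ g (ι m) ≃ g (ι (suc m)) -ₚ g (ι m)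
  Δ-ι g g-lip m = -ₚ-cong (OneLipschitz⇒≃-cong g g-lip (ι-+1 m)) (≃-refl {x = g (ι m)})

  vdP-small : (h : ℤp p → ℤp p) → ∀ {m} → m < p → vdP h m ≃ h (ι m)
  vdP-small h {m} m<p with m <? p
  ... | yes _   = ≃-refl
  ... | no m≮p = contradiction m<p m≮p

  -- The case split is made on the sequences: abstracting m <? p in a goal
  -- that mentions _-ₚ_ would normalise the proofs in its compat field.
  vdP-large : (h : ℤp p → ℤp p) → ∀ {m t} → p ≤ m → m ∸ q p m ≡ t →
              vdP h m ≃ h (ι m) -ₚ h (ι t)
  vdP-large h {m} p≤m refl = seq-≡⇒≃ seq-vdP
    where
    seq-vdP : ∀ j → seq (vdP h m) j ≡ seq (h (ι m)) j ℤ.- seq (h (ι (m ∸ q p m))) j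
    seq-vdP j with m <? p
    ... | yes m<p = contradiction p≤m (<⇒≱ m<p)
    ... | no _    = refl

  vdP-cong : {h h' : ℤp p → ℤp p} → (∀ x → h x ≃ h' x) → ∀ m → vdP h m ≃ vdP h' m
  vdP-cong h≃h' m with m <? p
  ... | yes _ = h≃h' (ι m)
  ... | no _  = -ₚ-cong (h≃h' (ι m)) (h≃h' (ι (m ∸ q p m)))

qAux-small : ∀ {p} fuel {m} → m < p → qAux fuel p m ≡ m
qAux-small zero _ = refl
qAux-small {suc p} (suc fuel) {m} m<p with m <? suc p
... | yes _   = refl
... | no m≮p = contradiction m<p m≮p

qAux-large : ∀ {p} fuel {m} .{{_ : ℕ.NonZero p}} → p ≤ m →
             qAux (suc fuel) p m ≡ p * qAux fuel p (m / p)
qAux-large {suc p} fuel {m} p≤m with m <? suc p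
... | yes m<p = contradiction p≤m (<⇒≱ m<p)
... | no _    = refl

module LeadingTerm {p : ℕ} (1<p : 1 < p) where

  instance
    p≢0 : ℕ.NonZero p
    p≢0 = ℕ.>-nonZero (<⇒≤ 1<p)

  n<p^n : ∀ n → n < p ^ n
  n<p^n zero    = s≤s z≤n
  n<p^n (suc n) = begin-strict
    suc n      ≤⟨ n<p^n n ⟩
    p ^ n      <⟨ m<m*n (p ^ n) p {{m^n≢0 p n}} 1<p ⟩
    p ^ n * p  ≡⟨ *-comm (p ^ n) p ⟩
    p ^ suc n  ∎
    where open ≤-Reasoning

  p≤p^ : ∀ {e} → 1 ≤ e → p ≤ p ^ e
  p≤p^ {suc e} _ = m≤m*n p (p ^ e) {{m^n≢0 p e}}

  p≤digits : ∀ {e d r} → 1 ≤ e → 1 ≤ d → p ≤ d * p ^ e + r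
  p≤digits {e} {d} {r} 1≤e 1≤d =
    ≤-trans (p≤p^ 1≤e) (≤-trans (m≤n*m (p ^ e) d {{ℕ.>-nonZero 1≤d}}) (m≤m+n _ r))

  qAux-leading : ∀ s fuel {d r} → s ≤ fuel → 1 ≤ d → d < p → r < p ^ s →
                 qAux fuel p (d * p ^ s + r) ≡ d * p ^ s
  qAux-leading zero fuel {d} {zero} _ _ d<p _
    rewrite +-identityʳ (d * 1) | *-identityʳ d = qAux-small fuel d<p
  qAux-leading zero _ {r = suc _} _ _ _ (s≤s ())
  qAux-leading (suc s) (suc fuel) {d} {r} (s≤s s≤fuel) 1≤d d<p r<p^s+1 = begin
    qAux (suc fuel) p m                  ≡⟨ qAux-large fuel (p≤digits {suc s} (s≤s z≤n) 1≤d) ⟩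
    p * qAux fuel p (m / p)              ≡⟨ cong (λ n → p * qAux fuel p n) m/p ⟩
    p * qAux fuel p (d * p ^ s + r / p)  ≡⟨ cong (p *_) (qAux-leading s fuel s≤fuel 1≤d d<p r/p<p^s) ⟩
    p * (d * p ^ s)                      ≡⟨ x∙yz≈y∙xz p d (p ^ s) ⟩
    d * p ^ suc s                        ∎
    where
    open ≡-Reasoning
    m : ℕ
    m = d * p ^ suc s + r
    m/p : m / p ≡ d * p ^ s + r / p
    m/p = begin
      (d * (p * p ^ s) + r) / p  ≡⟨ cong (λ n → (n + r) / p) (x∙yz≈xz∙y d p (p ^ s)) ⟩
      (d * p ^ s * p + r) / p    ≡⟨ +-distrib-/-∣ˡ r (divides (d * p ^ s) refl) ⟩
      d * p ^ s * p / p + r / p  ≡⟨ cong (_+ r / p) (m*n/n≡m (d * p ^ s) p) ⟩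
      d * p ^ s + r / p          ∎
    r/p<p^s : r / p < p ^ s
    r/p<p^s = m<n*o⇒m/o<n (<-≤-trans r<p^s+1 (≤-reflexive (*-comm p (p ^ s))))

  q-leading : ∀ s {d r m} → 1 ≤ d → d < p → r < p ^ s → m ≡ d * p ^ s + r → q p m ≡ d * p ^ s
  q-leading s {d} {r} 1≤d d<p r<p^s refl = qAux-leading s (d * p ^ s + r) s≤m 1≤d d<p r<p^s
    where
    s≤m : s ≤ d * p ^ s + r
    s≤m = ≤-trans (<⇒≤ (n<p^n s)) (≤-trans (m≤n*m (p ^ s) d {{ℕ.>-nonZero 1≤d}}) (m≤m+n _ r))

  ∸q-leading : ∀ s {d r m} → 1 ≤ d → d < p → r < p ^ s → m ≡ d * p ^ s + r → m ∸ q p m ≡ r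
  ∸q-leading s {d} {r} {m} 1≤d d<p r<p^s m≡ = begin
    m ∸ q p m                  ≡⟨ cong₂ _∸_ m≡ (q-leading s 1≤d d<p r<p^s m≡) ⟩
    d * p ^ s + r ∸ d * p ^ s  ≡⟨ m+n∸m≡n (d * p ^ s) r ⟩
    r                          ∎
    where open ≡-Reasoning

  q-multiple : ∀ s {c m} → 1 ≤ c → c ≤ p → m ≡ c * p ^ s → q p m ≡ m
  q-multiple s {c} {m} 1≤c c≤p m≡ with m≤n⇒m<n∨m≡n c≤p
  ... | inj₁ c<p  = trans (q-leading s 1≤c c<p (m^n>0 p s) (trans m≡ (sym (+-identityʳ _)))) (sym m≡)
  ... | inj₂ refl = trans (q-leading (suc s) ≤-refl 1<p (m^n>0 p (suc s)) m≡digits) (sym m≡1*p^s+1)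
    where
    m≡1*p^s+1 : m ≡ 1 * p ^ suc s
    m≡1*p^s+1 = trans m≡ (sym (*-identityˡ (p ^ suc s)))
    m≡digits : m ≡ 1 * p ^ suc s + 0
    m≡digits = trans m≡1*p^s+1 (sym (+-identityʳ _))

  ∸q-multiple : ∀ s {c m} → 1 ≤ c → c ≤ p → m ≡ c * p ^ s → m ∸ q p m ≡ 0
  ∸q-multiple s {c} {m} 1≤c c≤p m≡ =
    trans (cong (m ∸_) (q-multiple s 1≤c c≤p m≡)) (n∸n≡0 m)

  leading-digit : ∀ s {m} → p ^ s ≤ m → m < p ^ suc s →
                  ∃₂ λ d r → 1 ≤ d × d < p × r < p ^ s × m ≡ d * p ^ s + r
  leading-digit s {m} p^s≤m m<p^s+1 =
    m / p ^ s , m % p ^ s , m≥n⇒m/n>0 p^s≤m , m<n*o⇒m/o<n {o = p ^ s} m<p^s+1 ,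
    m%n<n m (p ^ s) , trans (m≡m%n+[m/n]*n m (p ^ s)) (+-comm (m % p ^ s) _)
    where
    instance
      p^s≢0 : ℕ.NonZero (p ^ s)
      p^s≢0 = m^n≢0 p s

module ΔCoefficients {p : ℕ} (1<p : 1 < p) (g : ℤp p → ℤp p) (g-lip : OneLipschitz g) where

  open LeadingTerm 1<p
  open import Relation.Binary.Reasoning.Setoid (≃-setoid p)

  private
    1≤p : 1 ≤ p
    1≤p = <⇒≤ 1<p

  vdP-Δ-small : ∀ {m} → m < p → vdP (Δ g) m ≃ g (ι (suc m)) -ₚ g (ι m)
  vdP-Δ-small {m} m<p = begin
    vdP (Δ g) m                ≈⟨ vdP-small (Δ g) m<p ⟩
    Δ g (ι m)                  ≈⟨ Δ-ι g g-lip m ⟩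
    g (ι (suc m)) -ₚ g (ι m)   ∎

  vdP-Δ-large : ∀ {m t} → p ≤ m → m ∸ q p m ≡ t →
                vdP (Δ g) m ≃ (g (ι (suc m)) -ₚ g (ι m)) -ₚ (g (ι (suc t)) -ₚ g (ι t))
  vdP-Δ-large {m} {t} p≤m tail =
    ≃-trans (vdP-large (Δ g) p≤m tail) (-ₚ-cong (Δ-ι g g-lip m) (Δ-ι g g-lip t))

  vdP-Δ-below-p-1 : ∀ {m} → suc m < p → vdP (Δ g) m ≃ vdP g (suc m) -ₚ vdP g m
  vdP-Δ-below-p-1 {m} m+1<p = begin
    vdP (Δ g) m                ≈⟨ vdP-Δ-small m<p ⟩
    g (ι (suc m)) -ₚ g (ι m)   ≈⟨ -ₚ-cong (vdP-small g m+1<p) (vdP-small g m<p) ⟨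
    vdP g (suc m) -ₚ vdP g m   ∎
    where
    m<p : m < p
    m<p = <-trans (n<1+n m) m+1<p

  vdP-Δ-p-1 : vdP (Δ g) (p ∸ 1) ≃ vdP g p +ₚ vdP g 0 -ₚ vdP g (p ∸ 1)
  vdP-Δ-p-1 = begin
    vdP (Δ g) (p ∸ 1)                                ≈⟨ vdP-Δ-small p-1<p ⟩
    g (ι (suc (p ∸ 1))) -ₚ g (ι (p ∸ 1))             ≡⟨ cong (λ n → g (ι n) -ₚ g (ι (p ∸ 1))) p-1+1 ⟩
    g (ι p) -ₚ g (ι (p ∸ 1))                         ≈⟨ -ₚ-via (g (ι p)) (g (ι (p ∸ 1))) (g (ι 0)) ⟩
    (g (ι p) -ₚ g (ι 0)) +ₚ g (ι 0) -ₚ g (ι (p ∸ 1))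
      ≈⟨ -ₚ-cong (+ₚ-cong (vdP-large g ≤-refl p∸q[p]≡0) (vdP-small g 1≤p)) (vdP-small g p-1<p) ⟨
    vdP g p +ₚ vdP g 0 -ₚ vdP g (p ∸ 1)              ∎
    where
    p-1+1 : suc (p ∸ 1) ≡ p
    p-1+1 = m+[n∸m]≡n 1≤p
    p-1<p : p ∸ 1 < p
    p-1<p = ≤-reflexive p-1+1
    p∸q[p]≡0 : p ∸ q p p ≡ 0
    p∸q[p]≡0 = ∸q-multiple 0 1≤p ≤-refl (sym (*-identityʳ p))

  vdP-Δ-without-carry : ∀ e {d r m} → 1 ≤ e → 1 ≤ d → d < p → suc r < p ^ e →
                        m ≡ d * p ^ e + r → vdP (Δ g) m ≃ vdP g (suc m) -ₚ vdP g m
  vdP-Δ-without-carry e {d} {r} {m} 1≤e 1≤d d<p r+1<p^e m≡ = begin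
    vdP (Δ g) m                                                ≈⟨ vdP-Δ-large p≤m tail ⟩
    (g (ι (suc m)) -ₚ g (ι m)) -ₚ (g (ι (suc r)) -ₚ g (ι r))
      ≈⟨ -ₚ-interchange (g (ι (suc m))) (g (ι m)) (g (ι (suc r))) (g (ι r)) ⟩
    (g (ι (suc m)) -ₚ g (ι (suc r))) -ₚ (g (ι m) -ₚ g (ι r))
      ≈⟨ -ₚ-cong (vdP-large g p≤m+1 tail+1) (vdP-large g p≤m tail) ⟨
    vdP g (suc m) -ₚ vdP g m                                   ∎
    where
    p≤m : p ≤ m
    p≤m = subst (p ≤_) (sym m≡) (p≤digits 1≤e 1≤d)
    p≤m+1 : p ≤ suc m
    p≤m+1 = m≤n⇒m≤1+n p≤m
    tail : m ∸ q p m ≡ r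
    tail = ∸q-leading e 1≤d d<p (<-trans (n<1+n r) r+1<p^e) m≡
    tail+1 : suc m ∸ q p (suc m) ≡ suc r
    tail+1 = ∸q-leading e 1≤d d<p r+1<p^e (trans (cong suc m≡) (sym (+-suc (d * p ^ e) r)))

  vdP-Δ-no-carry : ∀ e {m} → 1 ≤ e → p ^ e ≤ m → m < p ^ suc e →
                   m ≢ p ^ e ∸ 1 + q p m → vdP (Δ g) m ≃ vdP g (suc m) -ₚ vdP g m
  vdP-Δ-no-carry e {m} 1≤e p^e≤m m<p^e+1 m≢ =
    let d , r , 1≤d , d<p , r<p^e , m≡ = leading-digit e p^e≤m m<p^e+1
        r+1≢p^e : suc r ≢ p ^ e
        r+1≢p^e r+1≡p^e = m≢ (trans m≡ (trans (+-comm (d * p ^ e) r)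
          (cong₂ _+_ (cong (_∸ 1) r+1≡p^e) (sym (q-leading e 1≤d d<p r<p^e m≡)))))
    in vdP-Δ-without-carry e 1≤e 1≤d d<p (≤∧≢⇒< r<p^e r+1≢p^e) m≡

  vdP-Δ-carry : ∀ e {d m} → 1 ≤ e → 1 ≤ d → d < p → m ≡ p ^ e ∸ 1 + d * p ^ e →
                vdP (Δ g) m ≃ vdP g (suc m) -ₚ vdP g m -ₚ vdP g (p ^ e)
  vdP-Δ-carry e {d} {m} 1≤e 1≤d d<p m≡ = begin
    vdP (Δ g) m                                                 ≈⟨ vdP-Δ-large p≤m tail ⟩
    (g (ι (suc m)) -ₚ g (ι m)) -ₚ (g (ι (suc (p ^ e ∸ 1))) -ₚ g (ι (p ^ e ∸ 1)))
      ≡⟨ cong (λ n → (g (ι (suc m)) -ₚ g (ι m)) -ₚ (g (ι n) -ₚ g (ι (p ^ e ∸ 1)))) p^e-1+1 ⟩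
    (g (ι (suc m)) -ₚ g (ι m)) -ₚ (g (ι (p ^ e)) -ₚ g (ι (p ^ e ∸ 1)))
      ≈⟨ -ₚ-interchange-via (g (ι (suc m))) (g (ι m)) (g (ι (p ^ e))) (g (ι (p ^ e ∸ 1))) (g (ι 0)) ⟩
    (g (ι (suc m)) -ₚ g (ι 0)) -ₚ (g (ι m) -ₚ g (ι (p ^ e ∸ 1))) -ₚ (g (ι (p ^ e)) -ₚ g (ι 0))
      ≈⟨ -ₚ-cong (-ₚ-cong (vdP-large g p≤m+1 tail+1) (vdP-large g p≤m tail))
                 (vdP-large g (p≤p^ 1≤e) tail[p^e]) ⟨
    vdP g (suc m) -ₚ vdP g m -ₚ vdP g (p ^ e)                  ∎
    where
    p^e-1+1 : suc (p ^ e ∸ 1) ≡ p ^ e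
    p^e-1+1 = m+[n∸m]≡n (m^n>0 p e)
    m≡digits : m ≡ d * p ^ e + (p ^ e ∸ 1)
    m≡digits = trans m≡ (+-comm (p ^ e ∸ 1) (d * p ^ e))
    p≤m : p ≤ m
    p≤m = subst (p ≤_) (sym m≡digits) (p≤digits 1≤e 1≤d)
    p≤m+1 : p ≤ suc m
    p≤m+1 = m≤n⇒m≤1+n p≤m
    tail : m ∸ q p m ≡ p ^ e ∸ 1
    tail = ∸q-leading e 1≤d d<p (≤-reflexive p^e-1+1) m≡digits
    tail+1 : suc m ∸ q p (suc m) ≡ 0
    tail+1 = ∸q-multiple e (s≤s z≤n) d<p (trans (cong suc m≡) (cong (_+ d * p ^ e) p^e-1+1))
    tail[p^e] : p ^ e ∸ q p (p ^ e) ≡ 0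
    tail[p^e] = ∸q-multiple e ≤-refl 1≤p (sym (*-identityˡ (p ^ e)))

≤∸1⇒< : ∀ {m n} → 1 ≤ n → m ≤ n ∸ 1 → m < n
≤∸1⇒< {n = suc _} _ = s≤s

proposition3p5 : (p : ℕ) → Prime p →
    (f g : ℤp p → ℤp p) → OneLipschitz f → OneLipschitz g →
    (B B̃ : ℕ → ℤp p) →
    (∀ m → B m ≈ vdP f m) → (∀ m → B̃ m ≈ vdP g m) →
    (∀ x → f x ≈ Δ g x) →
    (∀ m → m ≤ p ∸ 2 → B m ≈ B̃ (suc m) -ₚ B̃ m)
    × (B (p ∸ 1) ≈ B̃ p +ₚ B̃ 0 -ₚ B̃ (p ∸ 1))
    × (∀ n m → 2 ≤ n → p ^ (n ∸ 1) ≤ m → m ≤ p ^ n ∸ 1 →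
         m ≢ p ^ (n ∸ 1) ∸ 1 + q p m →
         B m ≈ B̃ (suc m) -ₚ B̃ m)
    × (∀ n d → 2 ≤ n → 1 ≤ d → d ≤ p ∸ 1 →
         B (p ^ (n ∸ 1) ∸ 1 + d * p ^ (n ∸ 1))
           ≈ B̃ (suc (p ^ (n ∸ 1) ∸ 1 + d * p ^ (n ∸ 1)))
             -ₚ B̃ (p ^ (n ∸ 1) ∸ 1 + d * p ^ (n ∸ 1))
             -ₚ B̃ (p ^ (n ∸ 1)))
-- Primality is used only through p ≥ 2, and f need not be 1-Lipschitz.
proposition3p5 zero ()
proposition3p5 (suc zero) ()
proposition3p5 p@(suc (suc k)) _ f g _ g-lip B B̃ B≈ B̃≈ f≈Δg =
  (λ m m≤k → consecutive (vdP-Δ-below-p-1 (s≤s (s≤s m≤k)))) ,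
  ≃⇒≈ (≃-trans (B≃ (p ∸ 1)) (≃-trans vdP-Δ-p-1
    (≃-sym (-ₚ-cong (+ₚ-cong (B̃≃ p) (B̃≃ 0)) (B̃≃ (p ∸ 1)))))) ,
  no-carry ,
  λ n d 2≤n 1≤d d≤p-1 →
    with-carry (vdP-Δ-carry (n ∸ 1) (∸-monoˡ-≤ 1 2≤n) 1≤d (s≤s d≤p-1) refl)
  where
  open ΔCoefficients {p} (s≤s (s≤s z≤n)) g g-lip

  B≃ : ∀ m → B m ≃ vdP (Δ g) m
  B≃ m = ≃-trans ⟦ B≈ m ⟧ (vdP-cong (λ x → ⟦ f≈Δg x ⟧) m)

  B̃≃ : ∀ m → B̃ m ≃ vdP g m
  B̃≃ m = ⟦ B̃≈ m ⟧

  consecutive : ∀ {m} → vdP (Δ g) m ≃ vdP g (suc m) -ₚ vdP g m → B m ≈ B̃ (suc m) -ₚ B̃ m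
  consecutive {m} eq = ≃⇒≈ (≃-trans (B≃ m) (≃-trans eq (≃-sym (-ₚ-cong (B̃≃ (suc m)) (B̃≃ m)))))

  with-carry : ∀ {m P} → vdP (Δ g) m ≃ vdP g (suc m) -ₚ vdP g m -ₚ vdP g P →
               B m ≈ B̃ (suc m) -ₚ B̃ m -ₚ B̃ P
  with-carry {m} {P} eq = ≃⇒≈ (≃-trans (B≃ m)
    (≃-trans eq (≃-sym (-ₚ-cong (-ₚ-cong (B̃≃ (suc m)) (B̃≃ m)) (B̃≃ P)))))

  no-carry : ∀ n m → 2 ≤ n → p ^ (n ∸ 1) ≤ m → m ≤ p ^ n ∸ 1 →
             m ≢ p ^ (n ∸ 1) ∸ 1 + q p m → B m ≈ B̃ (suc m) -ₚ B̃ m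
  no-carry 1 _ (s≤s ())
  no-carry (suc (suc s)) m _ p^s+1≤m m≤p^s+2-1 m≢ = consecutive
    (vdP-Δ-no-carry (suc s) (s≤s z≤n) p^s+1≤m (≤∸1⇒< (m^n>0 p (2 + s)) m≤p^s+2-1) m≢)
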